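{- Let $r$ and $s$ be positive integers with $r \geq s \geq 2$. If $r > 2s - 2$, then $f(s,r,2) = f(s,r,\mathbb{Z}) = 2s + 2r - 2$.
   Context: For integers $a\le b$, $[a,b]=\{n\in\mathbb{N} : a\le n\le b\}$. For a finite set $X\subseteq\mathbb{N}$, $\mathrm{diam}(X)=\max(X)-\min(X)$. $f(s,r,2)$ is the smallest positive integer $n$ such that for every coloring $\Delta:[1,n]\to\{1,2\}$ there exist $S_1,S_2\subseteq[1,n]$ with: (a) $S_1$, $S_2$ each monochromatic (not necessarily the same color); (b) $|S_1|=s$, $|S_2|=r$; (c) $\max(S_1)<\min(S_2)$; (d) $\mathrm{diam}(S_1)\le\mathrm{diam}(S_2)$. Given $\Delta:[1,n]\to\mathbb{Z}$, a subset $Y$ is zero-sum mod $m$ if $\sum_{y\in Y}\Delta(y)\equiv 0\pmod m$. $f(s,r,\mathbb{Z})$ is the smallest positive integer $n$ such that for every coloring $\Delta:[1,n]\to\mathbb{Z}$ there exist $S_1,S_2\subseteq[1,n]$ satisfying (b), (c), (d) and (a') $S_1$ is zero-sum mod $s$ and $S_2$ is zero-sum mod $r$. -}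

module Defs where

open import Data.Nat using (ℕ; zero; suc; _+_; _∸_; _≤_; _<_; _⊔_; _⊓_)
open import Data.Integer as ℤ using (ℤ; +_)
open import Data.Integer.Divisibility using () renaming (_∣_ to _∣ℤ_)
open import Data.Fin using (Fin)
open import Data.List using (List; []; _∷_; length; foldr; map)
open import Data.List.Relation.Unary.All using (All)
open import Data.List.Relation.Unary.Unique.Propositional using (Unique)
open import Data.Product using (Σ; ∃; _×_)
open import Relation.Binary.PropositionalEquality using (_≡_)
open import Relation.Nullary using (¬_)

record FinSubset (n k : ℕ) : Set where
  constructor mkSub
  field
    elems  : List ℕ
    unique : Unique elems
    inRange : All (λ x → 1 ≤ x × x ≤ n) elems
    size   : length elems ≡ k
open FinSubset public

-- max and min of a finite set (only used on nonempty sets)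
maxL : List ℕ → ℕ
maxL = foldr _⊔_ 0

minL : List ℕ → ℕ
minL []       = 0
minL (x ∷ xs) = foldr _⊓_ x xs

diam : List ℕ → ℕ
diam X = maxL X ∸ minL X

Monochromatic : (ℕ → Fin 2) → List ℕ → Set
Monochromatic Δ Y = ∃ λ c → All (λ y → Δ y ≡ c) Y

sumℤ : (ℕ → ℤ) → List ℕ → ℤ
sumℤ Δ Y = foldr ℤ._+_ (+ 0) (map Δ Y)

ZeroSumMod : ℕ → (ℕ → ℤ) → List ℕ → Set
ZeroSumMod m Δ Y = (+ m) ∣ℤ sumℤ Δ Y

Arranged : List ℕ → List ℕ → Set
Arranged S₁ S₂ = maxL S₁ < minL S₂ × diam S₁ ≤ diam S₂

-- Property defining f(s,r,2) at n: every 2-coloring of [1,n] admits S₁, S₂.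
-- (Colorings are functions ℕ → Fin 2; only their values on [1,n] matter.)
Prop2 : ℕ → ℕ → ℕ → Set
Prop2 s r n = (Δ : ℕ → Fin 2) →
  Σ (FinSubset n s) λ S₁ → Σ (FinSubset n r) λ S₂ →
    Monochromatic Δ (elems S₁) × Monochromatic Δ (elems S₂) ×
    Arranged (elems S₁) (elems S₂)

PropZ : ℕ → ℕ → ℕ → Set
PropZ s r n = (Δ : ℕ → ℤ) →
  Σ (FinSubset n s) λ S₁ → Σ (FinSubset n r) λ S₂ →
    ZeroSumMod s Δ (elems S₁) × ZeroSumMod r Δ (elems S₂) ×
    Arranged (elems S₁) (elems S₂)

IsLeastPositive : (ℕ → Set) → ℕ → Set
IsLeastPositive P m = 1 ≤ m × P m × (∀ n → 1 ≤ n → n < m → ¬ P n)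

{-# OPTIONS --safe #-}
module Submission where

-- By the Erdős–Ginzburg–Ziv theorem (among any 2m − 1 integers some m have a sum
-- divisible by m), the block 1, …, 2s − 1 contains s integers whose colours sum to 0 mod s, and
-- the block 2s, …, 2s + 2r − 2 contains r integers whose colours sum to 0 mod r. The first set has
-- diameter at most 2s − 2 ≤ r − 1, the second at least r − 1. For a 2-colouring the colours are
-- 0/1 weights, and k such weights summing to 0 mod k are all equal, i.e. the set is monochromatic.
--
-- Colour by parity: k integers of one parity span at least 2(k − 1), so
-- max S₁ ≥ 2s − 1, min S₂ ≥ 2s and max S₂ ≥ 2s + 2r − 2. The same colouring, read as integers,
-- defeats the zero-sum version, since zero-sum sets of 0/1 weights are monochromatic.
--
-- Erdős–Ginzburg–Ziv is multiplicative in m, so it suffices to treat a prime p. Sort 2p − 1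
-- elements by residue. Either some p consecutive ones share a residue, or the p − 1 pairs
-- (yᵢ, yᵢ₊ₚ₋₁) have distinct residues; then, by the Cauchy–Davenport argument, choosing one
-- element from each pair attains every residue, in particular minus that of the last element.

open import Defs
open import Data.Nat
  using (ℕ; zero; suc; pred; _+_; _*_; _∸_; _≤_; _<_; _⊓_; z≤n; s≤s; NonZero; >-nonZero; >-nonZero⁻¹; _≟_; _%_; _/_)
open import Data.Nat.Properties
open import Data.Nat.DivMod
  using (_mod_; n%1≡0; m≡m%n+[m/n]*n; m*n%n≡0; m*[n/m]≡n; %-distribˡ-+; %-remove-+ʳ; m%n≤n; m%n<n; m%n%n≡m%n
        ; m<n⇒m%n≡m; /-monoˡ-≤; m/n*n≤m)
open import Data.Nat.Divisibility using (_∣_; divides; *-monoʳ-∣; ∣⇒≤; n∣m⇒m%n≡0; m%n≡0⇒n∣m; 1∣_)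
open import Data.Nat.ListAction using (sum; product)
open import Data.Nat.ListAction.Properties using (sum-++; product≢0)
open import Data.Nat.Primality using (Prime; euclidsLemma; prime⇒nonZero)
open import Data.Nat.Primality.Factorisation using (PrimeFactorisation; factorise)
open import Data.Integer as ℤ using (ℤ)
import Data.Integer.Properties as ℤ
open import Data.Integer.DivMod using (_%ℕ_; _/ℕ_; a≡a%ℕn+[a/ℕn]*n)
open import Data.Integer.Divisibility.Signed
  using (∣ᵤ⇒∣; ∣⇒∣ᵤ; ∣m∣n⇒∣m+n; ∣n⇒∣m*n) renaming (_∣_ to _∣ₛ_; ∣-refl to ∣ₛ-refl)
open import Data.Integer.Tactic.RingSolver using () renaming (solve-∀ to ℤ-solve-∀)
open import Data.Fin as Fin using (Fin; toℕ)
open import Data.Fin.Properties using (toℕ-injective; toℕ<n; toℕ-fromℕ<)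
open import Data.List using (List; foldr; []; _∷_; [_]; _++_; length; map; concat; upTo; applyUpTo)
open import Data.List.Properties
  using (map-++; concat-++; foldr-preservesᵇ; length-map; length-applyUpTo; length-upTo; ++-assoc; length-++)
open import Data.List.Relation.Unary.All as All using (All; []; _∷_; all?)
import Data.List.Relation.Unary.All.Properties as All
open import Data.List.Relation.Unary.Any using (here; there)
open import Data.List.Relation.Unary.AllPairs using ([]; _∷_)
open import Data.List.Relation.Unary.Linked as Linked using (Linked; _∷_)
open import Data.List.Relation.Unary.Unique.Propositional using (Unique)
open import Data.List.Relation.Unary.Unique.Propositional.Properties using (applyUpTo⁺₁; upTo⁺)
open import Data.List.Relation.Binary.Pointwise using (Pointwise; []; _∷_)
open import Data.List.Relation.Binary.Subset.Propositional using (_⊆_)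
open import Data.List.Membership.Propositional using (_∈_; find)
open import Data.List.Membership.Propositional.Properties
  using (∈-∃++; ∈-map⁻; ∈-upTo⁺; ∈-upTo⁻; ∈-applyUpTo⁻)
open import Data.List.Membership.DecPropositional _≟_ using (_∈?_)
open import Data.List.Relation.Binary.Permutation.Propositional
  using (_↭_; ↭-refl; ↭-sym; ↭-trans; ↭-reflexive; ↭-prep; ↭-swap; ↭-setoid; ↭-isEquivalence; ↭⇒↭ₛ; ↭⇒↭ₛ′
        ; module PermutationReasoning)
open import Data.List.Relation.Binary.Permutation.Propositional.Properties
  using (↭-length; shift; ∈-resp-↭; ++⁺ʳ; ++⁺ˡ; All-resp-↭; ++-isCommutativeMonoid)
import Data.List.Relation.Binary.Permutation.Setoid.Properties as Setoid↭
import Data.List.Sort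
import Relation.Binary.Construct.On as On
open import Data.Product using (Σ; ∃; ∃₂; _×_; _,_; proj₁; proj₂)
open import Data.Sum as Sum using (_⊎_; inj₁; inj₂; [_,_]′)
open import Function using (_∘_)
open import Relation.Binary.PropositionalEquality hiding ([_])
open import Relation.Nullary using (¬_; contradiction; yes; no)

private
  variable
    A B : Set

Unique∧⊆⇒length≤ : {xs ys : List A} → Unique xs → xs ⊆ ys → length xs ≤ length ys
Unique∧⊆⇒length≤ {xs = []} _ _ = z≤n
Unique∧⊆⇒length≤ {xs = x ∷ xs} (x∉xs ∷ xs!) xs⊆ys
  with ys₁ , ys₂ , refl ← ∈-∃++ (xs⊆ys (here refl)) = begin
    suc (length xs)           ≤⟨ s≤s (Unique∧⊆⇒length≤ xs! xs⊆ys₁++ys₂) ⟩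
    suc (length (ys₁ ++ ys₂)) ≡⟨ ↭-length (shift x ys₁ ys₂) ⟨
    length (ys₁ ++ x ∷ ys₂)   ∎
  where
  open ≤-Reasoning
  xs⊆ys₁++ys₂ : xs ⊆ ys₁ ++ ys₂
  xs⊆ys₁++ys₂ y∈xs with ∈-resp-↭ (shift x ys₁ ys₂) (xs⊆ys (there y∈xs))
  ... | here y≡x = contradiction (sym y≡x) (All.lookup x∉xs y∈xs)
  ... | there y∈ = y∈

Unique-map⁺ : {f : A → B} {xs : List A} →
              (∀ {x y} → x ∈ xs → y ∈ xs → f x ≡ f y → x ≡ y) →
              Unique xs → Unique (map f xs)
Unique-map⁺ _   []           = []
Unique-map⁺ inj (x∉xs ∷ xs!) =
  All.map⁺ (All.tabulate λ y∈xs fx≡fy → All.lookup x∉xs y∈xs (inj (here refl) (there y∈xs) fx≡fy))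
  ∷ Unique-map⁺ (λ x∈ y∈ → inj (there x∈) (there y∈)) xs!

injection⇒length≤ : {f : A → B} {xs : List A} {ys : List B} → Unique xs →
                    (∀ {x y} → x ∈ xs → y ∈ xs → f x ≡ f y → x ≡ y) →
                    (∀ {x} → x ∈ xs → f x ∈ ys) → length xs ≤ length ys
injection⇒length≤ {f = f} {xs} {ys} xs! inj into =
  subst (_≤ length ys) (length-map f xs) (Unique∧⊆⇒length≤ (Unique-map⁺ inj xs!) fxs⊆ys)
  where
  fxs⊆ys : map f xs ⊆ ys
  fxs⊆ys y∈ with _ , x∈ , refl ← ∈-map⁻ f y∈ = into x∈

Unique∧length≥⇒upTo⊆ : ∀ {n} {ts : List ℕ} → Unique ts → All (_< n) ts → n ≤ length ts → upTo n ⊆ ts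
Unique∧length≥⇒upTo⊆ {n} {ts} ts! ts<n n≤|ts| {u} u∈upTo with u ∈? ts
... | yes u∈ts = u∈ts
... | no  u∉ts = contradiction (≤-trans |u∷ts|≤n n≤|ts|) 1+n≰n
  where
  u∷ts⊆upTo : u ∷ ts ⊆ upTo n
  u∷ts⊆upTo (here refl) = ∈-upTo⁺ (∈-upTo⁻ u∈upTo)
  u∷ts⊆upTo (there t∈)  = ∈-upTo⁺ (All.lookup ts<n t∈)
  |u∷ts|≤n : suc (length ts) ≤ n
  |u∷ts|≤n = subst (suc (length ts) ≤_) (length-upTo n)
               (Unique∧⊆⇒length≤ (All.¬Any⇒All¬ ts u∉ts ∷ ts!) u∷ts⊆upTo)

Unique-resp-↭ : {xs ys : List A} → xs ↭ ys → Unique xs → Unique ys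
Unique-resp-↭ {A = A} xs↭ys = Setoid↭.Unique-resp-↭ (setoid A) (↭⇒↭ₛ xs↭ys)

Unique-++⁻ˡ : ∀ (xs : List A) {ys} → Unique (xs ++ ys) → Unique xs
Unique-++⁻ˡ []       _                = []
Unique-++⁻ˡ (x ∷ xs) (x∉ ∷ xs++ys!) = All.++⁻ˡ xs x∉ ∷ Unique-++⁻ˡ xs xs++ys!

concat-↭ : {xss yss : List (List A)} → xss ↭ yss → concat xss ↭ concat yss
concat-↭ xss↭yss =
  Setoid↭.foldr-commMonoid ↭-setoid ++-isCommutativeMonoid (↭⇒↭ₛ′ ↭-isEquivalence xss↭yss)

++-split : ∀ n {k} (xs : List A) → n + k ≤ length xs →
           ∃₂ λ ys zs → xs ≡ ys ++ zs × length ys ≡ n × k ≤ length zs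
++-split zero    xs       k≤ = [] , xs , refl , refl , k≤
++-split (suc n) (x ∷ xs) (s≤s n+k≤) with ys , zs , refl , refl , k≤ ← ++-split n xs n+k≤ =
  x ∷ ys , zs , refl , refl , k≤

++-split-middle : ∀ k (xs : List A) → k + suc k ≤ length xs →
                  ∃₂ λ B C → ∃₂ λ z D → xs ≡ B ++ C ++ z ∷ D × length B ≡ k × length C ≡ k
++-split-middle k xs k+1+k≤
  with B , rest , refl , |B| , 1+k≤ ← ++-split k xs k+1+k≤
  with C , z ∷ D , refl , |C| , _  ← ++-split k {1} rest (subst (_≤ length rest) (+-comm 1 k) 1+k≤)
  = B , C , z , D , refl , |B| , |C|

sorted-window : (f : A → ℕ) {b c : A} (M : List A) {T : List A} →
                Linked (λ x y → f x ≤ f y) (b ∷ M ++ c ∷ T) → f c ≤ f b →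
                All (λ z → f z ≡ f c) (b ∷ M ++ [ c ])
sorted-window f []      (b≤c ∷ _)      c≤b = ≤-antisym b≤c c≤b ∷ refl ∷ []
sorted-window f (m ∷ M) (b≤m ∷ sorted) c≤b with m≡c ∷ M+c≡c ← sorted-window f M sorted (≤-trans c≤b b≤m) =
  ≤-antisym (≤-trans b≤m (≤-reflexive m≡c)) c≤b ∷ m≡c ∷ M+c≡c

-- Congruences modulo n

module _ (n : ℕ) .{{_ : NonZero n}} where

  %-cong-+ : ∀ {a b c d} → a % n ≡ b % n → c % n ≡ d % n → (a + c) % n ≡ (b + d) % n
  %-cong-+ {a} {b} {c} {d} a≡b c≡d = begin
    (a + c) % n          ≡⟨ %-distribˡ-+ a c n ⟩
    (a % n + c % n) % n  ≡⟨ cong₂ (λ x y → (x + y) % n) a≡b c≡d ⟩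
    (b % n + d % n) % n  ≡⟨ %-distribˡ-+ b d n ⟨
    (b + d) % n          ∎
    where open ≡-Reasoning

  neg : ℕ → ℕ
  neg c = n ∸ c % n

  ∣+neg : ∀ c → n ∣ c + neg c
  ∣+neg c = divides (suc (c / n)) (begin
    c + (n ∸ c % n)                   ≡⟨ cong (_+ (n ∸ c % n)) (m≡m%n+[m/n]*n c n) ⟩
    c % n + c / n * n + (n ∸ c % n)   ≡⟨ +-assoc (c % n) _ _ ⟩
    c % n + (c / n * n + (n ∸ c % n)) ≡⟨ cong (c % n +_) (+-comm (c / n * n) _) ⟩
    c % n + ((n ∸ c % n) + c / n * n) ≡⟨ +-assoc (c % n) _ _ ⟨
    c % n + (n ∸ c % n) + c / n * n   ≡⟨ cong (_+ c / n * n) (m+[n∸m]≡n (m%n≤n c n)) ⟩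
    n + c / n * n                     ∎)
    where open ≡-Reasoning

  %-+-neg : ∀ a c → (a + c + neg c) % n ≡ a % n
  %-+-neg a c = trans (cong (_% n) (+-assoc a c (neg c))) (%-remove-+ʳ a (∣+neg c))

  +-cancelʳ-% : ∀ {a b} c → (a + c) % n ≡ (b + c) % n → a % n ≡ b % n
  +-cancelʳ-% {a} {b} c a+c≡b+c = begin
    a % n                ≡⟨ %-+-neg a c ⟨
    (a + c + neg c) % n  ≡⟨ %-cong-+ a+c≡b+c refl ⟩
    (b + c + neg c) % n  ≡⟨ %-+-neg b c ⟩
    b % n                ∎
    where open ≡-Reasoning

  +-cancelˡ-% : ∀ c {a b} → (c + a) % n ≡ (c + b) % n → a % n ≡ b % n
  +-cancelˡ-% c {a} {b} c+a≡c+b =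
    +-cancelʳ-% c (trans (cong (_% n) (+-comm a c)) (trans c+a≡c+b (cong (_% n) (+-comm c b))))

  %-+-absorbs⇒∣ : ∀ a b → (a + b) % n ≡ a % n → n ∣ b
  %-+-absorbs⇒∣ a b a+b≡a = m%n≡0⇒n∣m b n (begin
    b % n  ≡⟨ +-cancelˡ-% a (trans a+b≡a (cong (_% n) (sym (+-identityʳ a)))) ⟩
    0 % n  ≡⟨ m<n⇒m%n≡m (>-nonZero⁻¹ n) ⟩
    0      ∎)
    where open ≡-Reasoning

  %∧/-injective : ∀ {a b} → a % n ≡ b % n → a / n ≡ b / n → a ≡ b
  %∧/-injective {a} {b} a%≡b% a/≡b/ = begin
    a                  ≡⟨ m≡m%n+[m/n]*n a n ⟩
    a % n + a / n * n  ≡⟨ cong₂ (λ r q → r + q * n) a%≡b% a/≡b/ ⟩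
    b % n + b / n * n  ≡⟨ m≡m%n+[m/n]*n b n ⟨
    b                  ∎
    where open ≡-Reasoning

  sum-%-constant : (w : A → ℕ) {r : ℕ} (xs : List A) → All (λ x → w x % n ≡ r) xs →
                   sum (map w xs) % n ≡ (length xs * r) % n
  sum-%-constant w []       []             = refl
  sum-%-constant w (x ∷ xs) (wx≡r ∷ wxs≡r) =
    %-cong-+ (trans (sym (m%n%n≡m%n (w x) n)) (cong (_% n) wx≡r)) (sum-%-constant w xs wxs≡r)

-- Extent of a finite set of naturals

maxL-≤ : ∀ {b} {xs : List ℕ} → All (_≤ b) xs → maxL xs ≤ b
maxL-≤ = foldr-preservesᵇ ⊔-lub z≤n

xs≤maxL : ∀ xs → All (_≤ maxL xs) xs
xs≤maxL []       = []
xs≤maxL (x ∷ xs) = m≤m⊔n x (maxL xs) ∷ All.map (λ y≤ → ≤-trans y≤ (m≤n⊔m x (maxL xs))) (xs≤maxL xs)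

≤-minL : ∀ {b} x xs → All (b ≤_) (x ∷ xs) → b ≤ minL (x ∷ xs)
≤-minL x xs (b≤x ∷ b≤xs) = foldr-preservesᵇ ⊓-glb b≤x b≤xs

minL≤xs : ∀ xs → All (minL xs ≤_) xs
minL≤xs []       = []
minL≤xs (x ∷ xs) = foldr-⊓≤ x xs
  where
  foldr-⊓≤ : ∀ x xs → All (foldr _⊓_ x xs ≤_) (x ∷ xs)
  foldr-⊓≤ x []       = ≤-refl ∷ []
  foldr-⊓≤ x (y ∷ ys) with m≤x ∷ m≤ys ← foldr-⊓≤ x ys =
    ≤-trans (m⊓n≤n y _) m≤x ∷ m⊓n≤m y _ ∷ All.map (≤-trans (m⊓n≤n y _)) m≤ys

minL+diam≡maxL : ∀ x xs → minL (x ∷ xs) + diam (x ∷ xs) ≡ maxL (x ∷ xs)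
minL+diam≡maxL x xs = m+[n∸m]≡n (≤-trans (All.head (minL≤xs (x ∷ xs))) (All.head (xs≤maxL (x ∷ xs))))

diam-≤ : ∀ {lo hi} (xs : List ℕ) → All (λ x → lo ≤ x × x ≤ hi) xs → diam xs ≤ hi ∸ lo
diam-≤ []       _      = z≤n
diam-≤ (x ∷ xs) bounds = ∸-mono (maxL-≤ (All.map proj₂ bounds)) (≤-minL x xs (All.map proj₁ bounds))

congruent-spread : ∀ m .{{_ : NonZero m}} {c} (xs : List ℕ) → Unique xs →
                   All (λ x → x % m ≡ c) xs → m * (length xs ∸ 1) ≤ diam xs
congruent-spread m []         _   _     = ≤-reflexive (*-zeroʳ m)
congruent-spread m xs@(x ∷ _) xs! xs≡c = begin
  m * (length xs ∸ 1)  ≤⟨ *-monoʳ-≤ m (∸-monoˡ-≤ 1 |xs|≤) ⟩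
  m * (diam xs / m)    ≡⟨ *-comm m _ ⟩
  diam xs / m * m      ≤⟨ m/n*n≤m (diam xs) m ⟩
  diam xs              ∎
  where
  open ≤-Reasoning
  lo = minL xs
  lo≤ : ∀ {y} → y ∈ xs → lo ≤ y
  lo≤ = All.lookup (minL≤xs xs)
  index : ℕ → ℕ
  index y = (y ∸ lo) / m
  -- all y − lo share one residue mod m, so their quotients by m tell them apart
  index-injective : ∀ {y z} → y ∈ xs → z ∈ xs → index y ≡ index z → y ≡ z
  index-injective {y} {z} y∈ z∈ =
    ∸-cancelʳ-≡ (lo≤ y∈) (lo≤ z∈) ∘ %∧/-injective m (+-cancelˡ-% m lo (begin-equality
      (lo + (y ∸ lo)) % m  ≡⟨ cong (_% m) (m+[n∸m]≡n (lo≤ y∈)) ⟩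
      y % m                ≡⟨ trans (All.lookup xs≡c y∈) (sym (All.lookup xs≡c z∈)) ⟩
      z % m                ≡⟨ cong (_% m) (m+[n∸m]≡n (lo≤ z∈)) ⟨
      (lo + (z ∸ lo)) % m  ∎))
  index-bounded : ∀ {y} → y ∈ xs → index y ∈ upTo (suc (diam xs / m))
  index-bounded y∈ = ∈-upTo⁺ (s≤s (/-monoˡ-≤ m (∸-monoˡ-≤ lo (All.lookup (xs≤maxL xs) y∈))))
  |xs|≤ : length xs ≤ suc (diam xs / m)
  |xs|≤ = subst (length xs ≤_) (length-upTo _) (injection⇒length≤ xs! index-injective index-bounded)

-- The Erdős–Ginzburg–Ziv theorem

ZeroSum : ℕ → (A → ℕ) → List A → Set
ZeroSum m w S = length S ≡ m × m ∣ sum (map w S)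

HasZeroSum : ℕ → (A → ℕ) → List A → Set
HasZeroSum m w xs = ∃₂ λ S R → xs ↭ S ++ R × ZeroSum m w S

module _ {m : ℕ} {w : A → ℕ} where

  HasZeroSum-resp-↭ : {xs ys : List A} → xs ↭ ys → HasZeroSum m w ys → HasZeroSum m w xs
  HasZeroSum-resp-↭ xs↭ys (S , R , ys↭S++R , S-zs) = S , R , ↭-trans xs↭ys ys↭S++R , S-zs

  HasZeroSum-∷ : ∀ x {xs} → HasZeroSum m w xs → HasZeroSum m w (x ∷ xs)
  HasZeroSum-∷ x (S , R , xs↭S++R , S-zs) =
    S , x ∷ R , ↭-trans (↭-prep x xs↭S++R) (↭-sym (shift x S R)) , S-zs

  HasZeroSum-++ʳ : ∀ {xs} ys → HasZeroSum m w xs → HasZeroSum m w (xs ++ ys)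
  HasZeroSum-++ʳ ys (S , R , xs↭S++R , S-zs) =
    S , R ++ ys , ↭-trans (++⁺ʳ ys xs↭S++R) (↭-reflexive (++-assoc S R ys)) , S-zs

-- “at least 2m − 1 elements”, stated without truncated subtraction
ErdősGinzburgZiv : ℕ → Set₁
ErdősGinzburgZiv m = ∀ {A : Set} (w : A → ℕ) xs → 2 * m ≤ suc (length xs) → HasZeroSum m w xs

egz-1 : ErdősGinzburgZiv 1
egz-1 w []       (s≤s ())
egz-1 w (x ∷ xs) _ = [ x ] , xs , ↭-refl , refl , 1∣ _

module PrimeModulus {p : ℕ} (prime : Prime p) where

  private instance
    p≢0 : NonZero p
    p≢0 = prime⇒nonZero prime

  _⊕_ : ℕ → ℕ → ℕ
  t ⊕ c = (t + c) % p

  ⊕-injective : ∀ {t u} c → t < p → u < p → t ⊕ c ≡ u ⊕ c → t ≡ u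
  ⊕-injective c t<p u<p t⊕c≡u⊕c =
    trans (sym (m<n⇒m%n≡m t<p)) (trans (+-cancelʳ-% p c t⊕c≡u⊕c) (m<n⇒m%n≡m u<p))

  translation-closed⇒p≤length : ∀ {d t₀} {ts : List ℕ} → ¬ p ∣ d → t₀ ∈ ts →
                                (∀ {t} → t ∈ ts → t ⊕ d ∈ ts) → p ≤ length ts
  translation-closed⇒p≤length {d} {t₀} {ts} p∤d t₀∈ts closed = begin
    p                           ≡⟨ length-applyUpTo orbit p ⟨
    length (applyUpTo orbit p)  ≤⟨ Unique∧⊆⇒length≤ (applyUpTo⁺₁ orbit p orbit-distinct) orbit⊆ts ⟩
    length ts                   ∎
    where
    open ≤-Reasoning
    orbit : ℕ → ℕ
    orbit zero    = t₀
    orbit (suc j) = orbit j ⊕ d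
    orbit∈ts : ∀ j → orbit j ∈ ts
    orbit∈ts zero    = t₀∈ts
    orbit∈ts (suc j) = closed (orbit∈ts j)
    orbit⊆ts : applyUpTo orbit p ⊆ ts
    orbit⊆ts t∈ with j , _ , refl ← ∈-applyUpTo⁻ orbit t∈ = orbit∈ts j
    orbit-% : ∀ j → orbit j % p ≡ (t₀ + j * d) % p
    orbit-% zero    = cong (_% p) (sym (+-identityʳ t₀))
    orbit-% (suc j) = begin-equality
      (orbit j + d) % p % p  ≡⟨ m%n%n≡m%n (orbit j + d) p ⟩
      (orbit j + d) % p      ≡⟨ %-cong-+ p (orbit-% j) refl ⟩
      (t₀ + j * d + d) % p   ≡⟨ cong (_% p) (trans (+-assoc t₀ (j * d) d) (cong (t₀ +_) (+-comm (j * d) d))) ⟩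
      (t₀ + suc j * d) % p   ∎
    -- orbit points i < j < p coincide only if p ∣ (j − i) d, which Euclid's lemma rules out
    orbit-distinct : ∀ {i j} → i < j → j < p → orbit i ≢ orbit j
    orbit-distinct {i} {j} i<j j<p orbit-i≡j = [ p∤j∸i , p∤d ]′ (euclidsLemma (j ∸ i) d prime p∣[j∸i]d)
      where
      p∣[j∸i]d : p ∣ (j ∸ i) * d
      p∣[j∸i]d = %-+-absorbs⇒∣ p (t₀ + i * d) ((j ∸ i) * d) (begin-equality
        (t₀ + i * d + (j ∸ i) * d) % p    ≡⟨ cong (_% p) (+-assoc t₀ (i * d) _) ⟩
        (t₀ + (i * d + (j ∸ i) * d)) % p  ≡⟨ cong (λ k → (t₀ + k) % p) (*-distribʳ-+ d i (j ∸ i)) ⟨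
        (t₀ + (i + (j ∸ i)) * d) % p      ≡⟨ cong (λ k → (t₀ + k * d) % p) (m+[n∸m]≡n (<⇒≤ i<j)) ⟩
        (t₀ + j * d) % p                  ≡⟨ orbit-% j ⟨
        orbit j % p                       ≡⟨ cong (_% p) orbit-i≡j ⟨
        orbit i % p                       ≡⟨ orbit-% i ⟩
        (t₀ + i * d) % p                  ∎)
      p∤j∸i : ¬ p ∣ j ∸ i
      p∤j∸i p∣j∸i = <⇒≱ (≤-<-trans (m∸n≤m j i) j<p) (∣⇒≤ {{>-nonZero (m<n⇒0<n∸m i<j)}} p∣j∸i)

  module _ {A : Set} (w : A → ℕ) where

    res : A → ℕ
    res x = w x % p

    Distinct : A → A → Set
    Distinct b c = res b ≢ res c

    Attainable : List A → List A → ℕ → Set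
    Attainable B C t = ∃₂ λ S R → B ++ C ↭ S ++ R × length S ≡ length B × sum (map w S) % p ≡ t

    sum-∷-% : ∀ x S {t} → sum (map w S) % p ≡ t → sum (map w (x ∷ S)) % p ≡ t ⊕ w x
    sum-∷-% x S {t} ΣS≡t = begin
      (w x + sum (map w S)) % p  ≡⟨ cong (_% p) (+-comm (w x) _) ⟩
      (sum (map w S) + w x) % p  ≡⟨ %-cong-+ p (trans (sym (m%n%n≡m%n _ p)) (cong (_% p) ΣS≡t)) refl ⟩
      (t + w x) % p              ∎
      where open ≡-Reasoning

    attainable-∷ˡ : ∀ {b c B C t} → Attainable B C t → Attainable (b ∷ B) (c ∷ C) (t ⊕ w b)
    attainable-∷ˡ {b} {c} {B} {C} (S , R , B++C↭S++R , |S| , ΣS) =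
      b ∷ S , c ∷ R , ↭-prep b B++cC↭S++cR , cong suc |S| , sum-∷-% b S ΣS
      where
      open PermutationReasoning
      B++cC↭S++cR : B ++ c ∷ C ↭ S ++ c ∷ R
      B++cC↭S++cR = begin
        B ++ c ∷ C  ↭⟨ shift c B C ⟩
        c ∷ B ++ C  ↭⟨ ↭-prep c B++C↭S++R ⟩
        c ∷ S ++ R  ↭⟨ shift c S R ⟨
        S ++ c ∷ R  ∎

    attainable-∷ʳ : ∀ {b c B C t} → Attainable B C t → Attainable (b ∷ B) (c ∷ C) (t ⊕ w c)
    attainable-∷ʳ {b} {c} {B} {C} (S , R , B++C↭S++R , |S| , ΣS) =
      c ∷ S , b ∷ R , bB++cC↭cS++bR , cong suc |S| , sum-∷-% c S ΣS
      where
      open PermutationReasoning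
      bB++cC↭cS++bR : b ∷ B ++ c ∷ C ↭ c ∷ S ++ b ∷ R
      bB++cC↭cS++bR = begin
        b ∷ B ++ c ∷ C  ↭⟨ ↭-prep b (shift c B C) ⟩
        b ∷ c ∷ B ++ C  ↭⟨ ↭-swap b c B++C↭S++R ⟩
        c ∷ b ∷ S ++ R  ↭⟨ ↭-prep c (shift b S R) ⟨
        c ∷ S ++ b ∷ R  ∎

    -- Cauchy–Davenport, in the form needed: if each pair (bᵢ, cᵢ) has distinct residues, at least
    -- min(p, |B| + 1) residues are attainable.
    record AttainedResidues (B C : List A) : Set where
      field
        residues   : List ℕ
        distinct   : Unique residues
        bounded    : All (_< p) residues
        attainable : All (Attainable B C) residues
        large      : suc (length B) ⊓ p ≤ length residues

    attained-[] : AttainedResidues [] []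
    attained-[] = record
      { residues   = [ 0 ]
      ; distinct   = [] ∷ []
      ; bounded    = >-nonZero⁻¹ p ∷ []
      ; attainable = ([] , [] , ↭-refl , refl , m<n⇒m%n≡m (>-nonZero⁻¹ p)) ∷ []
      ; large      = m⊓n≤m 1 p
      }

    module Extension {b c B C} (b≢c : Distinct b c) (R : AttainedResidues B C) where
      open AttainedResidues R

      shifted : List ℕ
      shifted = map (_⊕ w b) residues

      shifted-distinct : Unique shifted
      shifted-distinct = Unique-map⁺
        (λ t∈ u∈ → ⊕-injective (w b) (All.lookup bounded t∈) (All.lookup bounded u∈)) distinct

      shifted-bounded : All (_< p) shifted
      shifted-bounded = All.map⁺ (All.universal (λ t → m%n<n (t + w b) p) residues)

      shifted-attainable : All (Attainable (b ∷ B) (c ∷ C)) shifted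
      shifted-attainable = All.map⁺ (All.map attainable-∷ˡ attainable)

      |shifted| : length shifted ≡ length residues
      |shifted| = length-map (_⊕ w b) residues

      some-residue : ∃ (_∈ residues)
      some-residue with residues | ≤-trans (⊓-glb (s≤s z≤n) (>-nonZero⁻¹ p)) large
      ... | t ∷ _ | _ = t , here refl

      d : ℕ
      d = w c + neg p (w b)

      p∤d : ¬ p ∣ d
      p∤d p∣d = b≢c (sym (+-cancelʳ-% p (neg p (w b)) (begin
        d % p                    ≡⟨ n∣m⇒m%n≡0 d p p∣d ⟩
        0                        ≡⟨ n∣m⇒m%n≡0 _ p (∣+neg p (w b)) ⟨
        (w b + neg p (w b)) % p  ∎)))
        where open ≡-Reasoning

      closed⇒translation-closed : All (λ t → t ⊕ w c ∈ shifted) residues →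
                                  ∀ {t} → t ∈ residues → t ⊕ d ∈ residues
      closed⇒translation-closed closed {t} t∈
        with u , u∈ , t⊕c≡u⊕b ← ∈-map⁻ (_⊕ w b) (All.lookup closed t∈) = subst (_∈ residues) u≡t⊕d u∈
        where
        open ≡-Reasoning
        u≡t⊕d : u ≡ t ⊕ d
        u≡t⊕d = begin
          u                            ≡⟨ m<n⇒m%n≡m (All.lookup bounded u∈) ⟨
          u % p                        ≡⟨ %-+-neg p u (w b) ⟨
          (u + w b + neg p (w b)) % p  ≡⟨ %-cong-+ p (sym t⊕c≡u⊕b) refl ⟩
          (t + w c + neg p (w b)) % p  ≡⟨ cong (_% p) (+-assoc t (w c) _) ⟩
          t ⊕ d                        ∎

      -- Either residues ⊕ w c ⊆ residues ⊕ w b, so the residues are closed under ⊕ d and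
      -- fill all of ℤ/p, or some t ⊕ w c is a new residue.
      attained-∷ : AttainedResidues (b ∷ B) (c ∷ C)
      attained-∷ with all? (λ t → t ⊕ w c ∈? shifted) residues
      ... | yes closed = record
        { residues   = shifted
        ; distinct   = shifted-distinct
        ; bounded    = shifted-bounded
        ; attainable = shifted-attainable
        ; large      = ≤-trans (m⊓n≤n _ p) (≤-trans p≤|residues| (≤-reflexive (sym |shifted|)))
        }
        where
        p≤|residues| : p ≤ length residues
        p≤|residues| = translation-closed⇒p≤length p∤d (proj₂ some-residue) (closed⇒translation-closed closed)
      ... | no ¬closed
        with t , t∈ , t⊕c∉ ← find (All.¬All⇒Any¬ (λ t → t ⊕ w c ∈? shifted) residues ¬closed) = record
        { residues   = t ⊕ w c ∷ shifted
        ; distinct   = All.¬Any⇒All¬ shifted t⊕c∉ ∷ shifted-distinct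
        ; bounded    = m%n<n (t + w c) p ∷ shifted-bounded
        ; attainable = attainable-∷ʳ (All.lookup attainable t∈) ∷ shifted-attainable
        ; large      = ≤-trans (⊓-monoʳ-≤ (suc (suc (length B))) (n≤1+n p))
                               (s≤s (≤-trans large (≤-reflexive (sym |shifted|))))
        }

    attained : ∀ {B C} → Pointwise Distinct B C → AttainedResidues B C
    attained []            = attained-[]
    attained (b≢c ∷ b≢cs) = Extension.attained-∷ b≢c (attained b≢cs)

    distinct-pairs⇒zero-sum : ∀ z {B C} → Pointwise Distinct B C → suc (length B) ≡ p →
                              HasZeroSum p w (z ∷ B ++ C)
    distinct-pairs⇒zero-sum z {B} {C} b≢c |zB|≡p =
      add-z (All.lookup attainable (upTo⊆residues (∈-upTo⁺ (m%n<n (neg p (w z)) p))))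
      where
      open AttainedResidues (attained b≢c)
      upTo⊆residues : upTo p ⊆ residues
      upTo⊆residues = Unique∧length≥⇒upTo⊆ distinct bounded
        (subst (_≤ length residues) (trans (cong (_⊓ p) |zB|≡p) (⊓-idem p)) large)
      add-z : Attainable B C (neg p (w z) % p) → HasZeroSum p w (z ∷ B ++ C)
      add-z (S , R , B++C↭S++R , |S| , ΣS) =
        z ∷ S , R , ↭-prep z B++C↭S++R , trans (cong suc |S|) |zB|≡p , m%n≡0⇒n∣m _ p (begin
          (w z + sum (map w S)) % p  ≡⟨ %-cong-+ p refl ΣS ⟩
          (w z + neg p (w z)) % p    ≡⟨ n∣m⇒m%n≡0 _ p (∣+neg p (w z)) ⟩
          0                          ∎)
        where open ≡-Reasoning

    Sorted : List A → Set
    Sorted = Linked (λ x y → res x ≤ res y)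

    window-zero-sum : ∀ {b c} W {T} → Sorted (b ∷ W ++ c ∷ T) → res b ≡ res c →
                      suc (suc (length W)) ≡ p → ZeroSum p w (b ∷ W ++ [ c ])
    window-zero-sum {b} {c} W sorted b≡c |bWc|≡p = |window| , m%n≡0⇒n∣m _ p (begin
      sum (map w window) % p       ≡⟨ sum-%-constant p w window (sorted-window res W sorted (≤-reflexive (sym b≡c))) ⟩
      (length window * res c) % p  ≡⟨ cong (λ k → (k * res c) % p) |window| ⟩
      (p * res c) % p              ≡⟨ cong (_% p) (*-comm p (res c)) ⟩
      (res c * p) % p              ≡⟨ m*n%n≡0 (res c) p ⟩
      0                            ∎)
      where
      open ≡-Reasoning
      window = b ∷ W ++ [ c ]
      |window| : length window ≡ p
      |window| = trans (cong suc (trans (length-++ W) (+-comm (length W) 1))) |bWc|≡p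

    -- Each cᵢ sits p − 1 places after bᵢ, so res bᵢ ≡ res cᵢ makes the p residues from bᵢ to cᵢ equal.
    scan : ∀ B M C {E} → Sorted (B ++ M ++ C ++ E) → length B ≡ length C → suc (length B + length M) ≡ p →
           Pointwise Distinct B C ⊎ HasZeroSum p w (B ++ M ++ C)
    scan []      M []      _      _       _ = inj₁ []
    scan (b ∷ B) M (c ∷ C) {E} sorted |bB|≡|cC| |bBM|≡p with res b ≟ res c
    ... | yes b≡c = inj₂ (b ∷ (B ++ M) ++ [ c ] , C , ↭-reflexive regroup ,
                          window-zero-sum (B ++ M) sorted′ b≡c (trans (cong (suc ∘ suc) (length-++ B)) |bBM|≡p))
      where
      regroup : b ∷ B ++ M ++ c ∷ C ≡ (b ∷ (B ++ M) ++ [ c ]) ++ C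
      regroup = cong (b ∷_) (sym (trans (++-assoc (B ++ M) [ c ] C) (++-assoc B M (c ∷ C))))
      sorted′ : Sorted (b ∷ (B ++ M) ++ c ∷ C ++ E)
      sorted′ = subst (λ xs → Sorted (b ∷ xs)) (sym (++-assoc B M (c ∷ C ++ E))) sorted
    ... | no b≢c = Sum.map (b≢c ∷_) (HasZeroSum-∷ b ∘ subst (HasZeroSum p w) (cong (B ++_) (++-assoc M [ c ] C)))
                     (scan B (M ++ [ c ]) C sorted′ (suc-injective |bB|≡|cC|) |BMc|≡p)
      where
      sorted′ : Sorted (B ++ (M ++ [ c ]) ++ C ++ E)
      sorted′ = subst (λ xs → Sorted (B ++ xs)) (sym (++-assoc M [ c ] (C ++ E))) (Linked.tail sorted)
      |BMc|≡p : suc (length B + length (M ++ [ c ])) ≡ p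
      |BMc|≡p = trans (cong (λ k → suc (length B + k)) (trans (length-++ M) (+-comm (length M) 1)))
                      (trans (cong suc (+-suc (length B) (length M))) |bBM|≡p)

    zero-sum-sorted-split : ∀ B C z D → Sorted (B ++ C ++ z ∷ D) → suc (length B) ≡ p →
                            length B ≡ length C → HasZeroSum p w (B ++ C ++ z ∷ D)
    zero-sum-sorted-split B C z D sorted |zB|≡p |B|≡|C|
      with scan B [] C sorted |B|≡|C| (trans (cong suc (+-identityʳ _)) |zB|≡p)
    ... | inj₂ found = HasZeroSum-resp-↭ (↭-reflexive (sym (++-assoc B C (z ∷ D))))
                         (HasZeroSum-++ʳ (z ∷ D) found)
    ... | inj₁ b≢c   = HasZeroSum-resp-↭ (↭-trans (↭-reflexive (sym (++-assoc B C (z ∷ D)))) (shift z (B ++ C) D))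
                         (HasZeroSum-++ʳ D (distinct-pairs⇒zero-sum z b≢c |zB|≡p))

    zero-sum-sorted : ∀ ys → Sorted ys → pred p + p ≤ length ys → HasZeroSum p w ys
    zero-sum-sorted ys sorted bound
      with B , C , z , D , refl , |B| , |C| ←
             ++-split-middle (pred p) ys (subst (λ k → pred p + k ≤ length ys) (sym (suc-pred p)) bound)
      = zero-sum-sorted-split B C z D sorted (trans (cong suc |B|) (suc-pred p)) (trans |B| (sym |C|))

    private module Sort = Data.List.Sort (On.decTotalOrder ≤-decTotalOrder res)

    zero-sum : ∀ xs → 2 * p ≤ suc (length xs) → HasZeroSum p w xs
    zero-sum xs 2p≤ =
      HasZeroSum-resp-↭ (↭-sym (Sort.sort-↭ xs)) (zero-sum-sorted (Sort.sort xs) (Sort.sort-↗ xs) bound)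
      where
      open ≤-Reasoning
      bound : pred p + p ≤ length (Sort.sort xs)
      bound = ≤-pred (begin
        suc (pred p + p)             ≡⟨ cong (_+ p) (suc-pred p) ⟩
        p + p                        ≡⟨ cong (p +_) (+-identityʳ p) ⟨
        2 * p                        ≤⟨ 2p≤ ⟩
        suc (length xs)              ≡⟨ cong suc (↭-length (Sort.sort-↭ xs)) ⟨
        suc (length (Sort.sort xs))  ∎)

  egz-prime : ErdősGinzburgZiv p
  egz-prime w = zero-sum w

blocks-remaining : ∀ {a n} {xs S R : List A} → xs ↭ S ++ R → length S ≡ a →
                   suc (suc n) * a ≤ suc (length xs) → suc n * a ≤ suc (length R)
blocks-remaining {a = a} {n} {xs} {S} {R} xs↭S++R |S| bound = +-cancelˡ-≤ a _ _ (begin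
  a + suc n * a              ≤⟨ bound ⟩
  suc (length xs)            ≡⟨ cong suc (trans (↭-length xs↭S++R) (length-++ S)) ⟩
  suc (length S + length R)  ≡⟨ cong (λ k → suc (k + length R)) |S| ⟩
  suc (a + length R)         ≡⟨ +-suc a (length R) ⟨
  a + suc (length R)         ∎)
  where open ≤-Reasoning

zero-sum-blocks : ∀ {a} → ErdősGinzburgZiv a → (w : A → ℕ) → ∀ n xs → suc n * a ≤ suc (length xs) →
                  ∃₂ λ Gs R → xs ↭ concat Gs ++ R × length Gs ≡ n × All (ZeroSum a w) Gs
zero-sum-blocks egz-a w zero    xs _ = [] , xs , ↭-refl , refl , []
zero-sum-blocks {a = a} egz-a w (suc n) xs bound
  with S , R , xs↭S++R , S-zs ← egz-a w xs (≤-trans (+-monoʳ-≤ a (+-monoʳ-≤ a z≤n)) bound)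
  with Gs , R′ , R↭Gs++R′ , |Gs| , Gs-zs ←
         zero-sum-blocks egz-a w n R (blocks-remaining {n = n} {S = S} xs↭S++R (proj₁ S-zs) bound)
  = S ∷ Gs , R′ , ↭-trans xs↭S++R (↭-trans (++⁺ˡ S R↭Gs++R′) (↭-reflexive (sym (++-assoc S (concat Gs) R′)))) ,
    cong suc |Gs| , S-zs ∷ Gs-zs

length-concat-uniform : ∀ {a} {Gs : List (List A)} → All (λ G → length G ≡ a) Gs →
                        length (concat Gs) ≡ length Gs * a
length-concat-uniform {Gs = []}     []           = refl
length-concat-uniform {Gs = G ∷ Gs} (|G| ∷ |Gs|) = trans (length-++ G) (cong₂ _+_ |G| (length-concat-uniform |Gs|))

sum-concat-∣ : ∀ {a} .{{_ : NonZero a}} (w : A → ℕ) {Gs} → All (λ G → a ∣ sum (map w G)) Gs →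
               sum (map w (concat Gs)) ≡ a * sum (map (λ G → sum (map w G) / a) Gs)
sum-concat-∣ {a = a} w {[]}     []           = sym (*-zeroʳ a)
sum-concat-∣ {a = a} w {G ∷ Gs} (a∣G ∷ a∣Gs) = begin
  sum (map w (G ++ concat Gs))                  ≡⟨ cong sum (map-++ w G (concat Gs)) ⟩
  sum (map w G ++ map w (concat Gs))            ≡⟨ sum-++ (map w G) _ ⟩
  sum (map w G) + sum (map w (concat Gs))       ≡⟨ cong₂ _+_ (m*[n/m]≡n a∣G) (sym (sum-concat-∣ w a∣Gs)) ⟨
  a * (sum (map w G) / a) + a * sum (map _ Gs)  ≡⟨ *-distribˡ-+ a _ _ ⟨
  a * sum (map _ (G ∷ Gs))                      ∎
  where open ≡-Reasoning

-- Cut 2b − 1 disjoint zero-sum a-blocks out of xs; b of them whose sums divided by a add up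
-- to a multiple of b form a zero-sum ab-set.
egz-* : ∀ {a b} .{{_ : NonZero a}} .{{_ : NonZero b}} →
        ErdősGinzburgZiv a → ErdősGinzburgZiv b → ErdősGinzburgZiv (a * b)
egz-* {a} {b@(suc _)} egz-a egz-b w xs bound
  with Gs , R , xs↭Gs++R , |Gs| , Gs-zs ←
         zero-sum-blocks egz-a w (pred (2 * b)) xs
           (subst (_≤ suc (length xs)) (trans (cong (2 *_) (*-comm a b)) (sym (*-assoc 2 b a))) bound)
  with T , U , Gs↭T++U , |T| , b∣ΣT ← egz-b (λ G → sum (map w G) / a) Gs (≤-reflexive (cong suc (sym |Gs|)))
  = concat T , concat U ++ R , xs↭T++U++R , |concatT| , ab∣ΣconcatT
  where
  T-zs : All (ZeroSum a w) T
  T-zs = All.++⁻ˡ T (All-resp-↭ Gs↭T++U Gs-zs)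
  xs↭T++U++R : xs ↭ concat T ++ concat U ++ R
  xs↭T++U++R = ↭-trans xs↭Gs++R (↭-trans (++⁺ʳ R (concat-↭ Gs↭T++U))
    (↭-reflexive (trans (cong (_++ R) (sym (concat-++ T U))) (++-assoc (concat T) (concat U) R))))
  |concatT| : length (concat T) ≡ a * b
  |concatT| = trans (length-concat-uniform (All.map proj₁ T-zs)) (trans (cong (_* a) |T|) (*-comm b a))
  ab∣ΣconcatT : a * b ∣ sum (map w (concat T))
  ab∣ΣconcatT = subst (a * b ∣_) (sym (sum-concat-∣ w (All.map proj₂ T-zs))) (*-monoʳ-∣ a b∣ΣT)

egz : ∀ m .{{_ : NonZero m}} → ErdősGinzburgZiv m
egz m = subst ErdősGinzburgZiv (sym isFactorisation) (egz-product factorsPrime)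
  where
  open PrimeFactorisation (factorise m)
  egz-product : ∀ {ps} → All Prime ps → ErdősGinzburgZiv (product ps)
  egz-product []         = egz-1
  egz-product (pr ∷ prs) = egz-* {{prime⇒nonZero pr}} {{product≢0 (All.map prime⇒nonZero prs)}}
                                 (PrimeModulus.egz-prime pr) (egz-product prs)

zero-sum-in-interval : ∀ k lo (w : ℕ → ℕ) →
                       ∃ λ S → Unique S × All (λ x → lo ≤ x × x ≤ lo + 2 * k) S × ZeroSum (suc k) w S
zero-sum-in-interval k lo w = restrict (egz (suc k) w interval bound)
  where
  interval : List ℕ
  interval = map (lo +_) (upTo (suc (2 * k)))
  |interval| : length interval ≡ suc (2 * k)
  |interval| = trans (length-map (lo +_) (upTo (suc (2 * k)))) (length-upTo _)
  bound : 2 * suc k ≤ suc (length interval)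
  bound = s≤s (≤-reflexive (trans (+-suc k (k + 0)) (sym |interval|)))
  interval-unique : Unique interval
  interval-unique = Unique-map⁺ (λ _ _ → +-cancelˡ-≡ lo _ _) (upTo⁺ _)
  interval-bounds : All (λ x → lo ≤ x × x ≤ lo + 2 * k) interval
  interval-bounds = All.map⁺ (All.tabulate λ i∈ → m≤m+n lo _ , +-monoʳ-≤ lo (≤-pred (∈-upTo⁻ i∈)))
  restrict : HasZeroSum (suc k) w interval →
             ∃ λ S → Unique S × All (λ x → lo ≤ x × x ≤ lo + 2 * k) S × ZeroSum (suc k) w S
  restrict (S , R , I↭S++R , S-zs) =
    S , Unique-++⁻ˡ S (Unique-resp-↭ I↭S++R interval-unique) , All.++⁻ˡ S (All-resp-↭ I↭S++R interval-bounds) , S-zs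

-- Zero-sum sets of colours

module _ (v : A → ℕ) where

  sum-map-≤ : ∀ {xs} → All (λ x → v x ≤ 1) xs → sum (map v xs) ≤ length xs
  sum-map-≤ []             = z≤n
  sum-map-≤ (vx≤1 ∷ vxs≤1) = +-mono-≤ vx≤1 (sum-map-≤ vxs≤1)

  sum-map-≡0 : ∀ xs → sum (map v xs) ≡ 0 → All (λ x → v x ≡ 0) xs
  sum-map-≡0 []       _   = []
  sum-map-≡0 (x ∷ xs) Σ≡0 = m+n≡0⇒m≡0 (v x) Σ≡0 ∷ sum-map-≡0 xs (m+n≡0⇒n≡0 (v x) Σ≡0)

  sum-map-≡length : ∀ {xs} → All (λ x → v x ≤ 1) xs → sum (map v xs) ≡ length xs → All (λ x → v x ≡ 1) xs
  sum-map-≡length               []             _     = []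
  sum-map-≡length {xs = x ∷ xs} (vx≤1 ∷ vxs≤1) Σ≡len with m≤n⇒m<n∨m≡n vx≤1
  ... | inj₂ vx≡1 =
    vx≡1 ∷ sum-map-≡length vxs≤1 (suc-injective (trans (cong (_+ sum (map v xs)) (sym vx≡1)) Σ≡len))
  ... | inj₁ vx<1 = contradiction (begin
    suc (length xs)       ≡⟨ Σ≡len ⟨
    v x + sum (map v xs)  ≡⟨ cong (_+ sum (map v xs)) (n<1⇒n≡0 vx<1) ⟩
    sum (map v xs)        ≤⟨ sum-map-≤ vxs≤1 ⟩
    length xs             ∎) 1+n≰n
    where open ≤-Reasoning

  zero-sum-01⇒constant : ∀ {k} xs → All (λ x → v x ≤ 1) xs → ZeroSum k v xs →
                         All (λ x → v x ≡ 0) xs ⊎ All (λ x → v x ≡ 1) xs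
  zero-sum-01⇒constant xs v≤1 (refl , len∣Σ) with sum (map v xs) in Σ≡
  ... | zero  = inj₁ (sum-map-≡0 xs Σ≡)
  ... | suc _ =
    inj₂ (sum-map-≡length v≤1 (trans Σ≡ (≤-antisym (subst (_≤ length xs) Σ≡ (sum-map-≤ v≤1)) (∣⇒≤ len∣Σ))))

zero-sum⇒monochromatic : ∀ {k} (Δ : ℕ → Fin 2) (xs : List ℕ) → ZeroSum k (toℕ ∘ Δ) xs → Monochromatic Δ xs
zero-sum⇒monochromatic Δ xs zs
  with zero-sum-01⇒constant (toℕ ∘ Δ) xs (All.universal (λ x → ≤-pred (toℕ<n (Δ x))) xs) zs
... | inj₁ Δ≡0 = Fin.zero , All.map toℕ-injective Δ≡0
... | inj₂ Δ≡1 = Fin.suc Fin.zero , All.map toℕ-injective Δ≡1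

sumℤ-+ : (f : ℕ → ℕ) (xs : List ℕ) → sumℤ (λ x → ℤ.+ f x) xs ≡ ℤ.+ sum (map f xs)
sumℤ-+ f []       = refl
sumℤ-+ f (x ∷ xs) = trans (cong (λ s → ℤ.+ f x ℤ.+ s) (sumℤ-+ f xs)) (sym (ℤ.pos-+ (f x) _))

module _ (m : ℕ) .{{_ : NonZero m}} (Δ : ℕ → ℤ) where

  residue : ℕ → ℕ
  residue x = Δ x %ℕ m

  residue-sum-congruent : ∀ xs → ∃ λ Q → sumℤ Δ xs ≡ ℤ.+ sum (map residue xs) ℤ.+ Q ℤ.* ℤ.+ m
  residue-sum-congruent []       = ℤ.+ 0 , refl
  residue-sum-congruent (x ∷ xs) with Q , Σ≡ ← residue-sum-congruent xs = q ℤ.+ Q , (begin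
    Δ x ℤ.+ sumℤ Δ xs                                    ≡⟨ cong₂ ℤ._+_ (a≡a%ℕn+[a/ℕn]*n (Δ x) m) Σ≡ ⟩
    (ℤ.+ r ℤ.+ q ℤ.* ℤ.+ m) ℤ.+ (ℤ.+ Σr ℤ.+ Q ℤ.* ℤ.+ m) ≡⟨ regroup (ℤ.+ r) (ℤ.+ Σr) q Q (ℤ.+ m) ⟩
    (ℤ.+ r ℤ.+ ℤ.+ Σr) ℤ.+ (q ℤ.+ Q) ℤ.* ℤ.+ m           ≡⟨ cong (ℤ._+ (q ℤ.+ Q) ℤ.* ℤ.+ m) (ℤ.pos-+ r Σr) ⟨
    ℤ.+ (r + Σr) ℤ.+ (q ℤ.+ Q) ℤ.* ℤ.+ m                 ∎)
    where
    open ≡-Reasoning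
    r = residue x
    q = Δ x /ℕ m
    Σr = sum (map residue xs)
    regroup : ∀ (a b q Q k : ℤ) → (a ℤ.+ q ℤ.* k) ℤ.+ (b ℤ.+ Q ℤ.* k) ≡ (a ℤ.+ b) ℤ.+ (q ℤ.+ Q) ℤ.* k
    regroup = ℤ-solve-∀

  residue-zero-sum⇒ZeroSumMod : ∀ xs → m ∣ sum (map residue xs) → ZeroSumMod m Δ xs
  residue-zero-sum⇒ZeroSumMod xs m∣Σr with Q , Σ≡ ← residue-sum-congruent xs =
    ∣⇒∣ᵤ (subst (ℤ.+ m ∣ₛ_) (sym Σ≡)
      (∣m∣n⇒∣m+n (∣ᵤ⇒∣ {ℤ.+ m} {ℤ.+ sum (map residue xs)} m∣Σr) (∣n⇒∣m*n Q ∣ₛ-refl)))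

parity : ℕ → Fin 2
parity x = x mod 2

monochromatic⇒congruent : ∀ {xs} → Monochromatic parity xs → ∃ λ c → All (λ x → x % 2 ≡ c) xs
monochromatic⇒congruent (c , parity≡c) =
  toℕ c , All.map (λ {x} px≡c → trans (sym (toℕ-fromℕ< (m%n<n x 2))) (cong toℕ px≡c)) parity≡c

parity-zero-sum⇒monochromatic : ∀ {n k} (S : FinSubset n k) →
                                ZeroSumMod k (λ x → ℤ.+ toℕ (parity x)) (elems S) → Monochromatic parity (elems S)
parity-zero-sum⇒monochromatic S k∣Σ = zero-sum⇒monochromatic parity (elems S)
  (size S , subst (_ ∣_) (cong ℤ.∣_∣ (sumℤ-+ (toℕ ∘ parity) (elems S))) k∣Σ)

-- The two bounds

parity-lower-bound : ∀ {n s′ r′} (S₁ : FinSubset n (suc s′)) (S₂ : FinSubset n (suc r′)) →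
                     Monochromatic parity (elems S₁) → Monochromatic parity (elems S₂) →
                     maxL (elems S₁) < minL (elems S₂) → 2 * suc s′ + 2 * r′ ≤ n
parity-lower-bound {n} {s′} {r′} (mkSub S₁@(x ∷ xs) S₁! S₁-range |S₁|) (mkSub S₂@(y ∷ ys) S₂! S₂-range |S₂|)
                   mono₁ mono₂ max<min = begin
  2 * suc s′ + 2 * r′               ≡⟨ cong (_+ 2 * r′) (*-suc 2 s′) ⟩
  suc (1 + 2 * s′) + 2 * r′         ≤⟨ +-monoˡ-≤ (2 * r′) (s≤s (+-mono-≤ 1≤minS₁ (spread mono₁ S₁! |S₁|))) ⟩
  suc (minL S₁ + diam S₁) + 2 * r′  ≡⟨ cong (λ k → suc k + 2 * r′) (minL+diam≡maxL x xs) ⟩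
  suc (maxL S₁) + 2 * r′            ≤⟨ +-monoˡ-≤ (2 * r′) max<min ⟩
  minL S₂ + 2 * r′                  ≤⟨ +-monoʳ-≤ (minL S₂) (spread mono₂ S₂! |S₂|) ⟩
  minL S₂ + diam S₂                 ≡⟨ minL+diam≡maxL y ys ⟩
  maxL S₂                           ≤⟨ maxL-≤ (All.map proj₂ S₂-range) ⟩
  n                                 ∎
  where
  open ≤-Reasoning
  1≤minS₁ : 1 ≤ minL S₁
  1≤minS₁ = ≤-minL x xs (All.map proj₁ S₁-range)
  spread : ∀ {k} {S : List ℕ} → Monochromatic parity S → Unique S → length S ≡ suc k → 2 * k ≤ diam S
  spread {S = S} mono S! |S| = subst (λ l → 2 * (l ∸ 1) ≤ diam S) |S|
    (congruent-spread 2 S S! (proj₂ (monochromatic⇒congruent mono)))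

arranged : ∀ {s′ r′} {S₁ S₂ : List ℕ} → 2 * s′ ≤ r′ → All (λ x → 1 ≤ x × x ≤ 1 + 2 * s′) S₁ →
           All (2 * suc s′ ≤_) S₂ → Unique S₂ → length S₂ ≡ suc r′ → Arranged S₁ S₂
arranged {s′} {r′} {S₁} {S₂@(y ∷ ys)} 2s′≤r′ S₁-bounds S₂-above S₂! |S₂| = max<min , diam≤diam
  where
  open ≤-Reasoning
  max<min : maxL S₁ < minL S₂
  max<min = begin-strict
    maxL S₁     ≤⟨ maxL-≤ (All.map proj₂ S₁-bounds) ⟩
    1 + 2 * s′  <⟨ n<1+n _ ⟩
    2 + 2 * s′  ≡⟨ *-suc 2 s′ ⟨
    2 * suc s′  ≤⟨ ≤-minL y ys S₂-above ⟩
    minL S₂     ∎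
  diam≤diam : diam S₁ ≤ diam S₂
  diam≤diam = begin
    diam S₁              ≤⟨ diam-≤ S₁ S₁-bounds ⟩
    2 * s′               ≤⟨ 2s′≤r′ ⟩
    r′                   ≡⟨ *-identityˡ r′ ⟨
    1 * (suc r′ ∸ 1)     ≡⟨ cong (λ l → 1 * (l ∸ 1)) |S₂| ⟨
    1 * (length S₂ ∸ 1)  ≤⟨ congruent-spread 1 S₂ S₂! (All.universal n%1≡0 S₂) ⟩
    diam S₂              ∎

arranged-zero-sum-pair : ∀ {s′ r′} → 2 * s′ ≤ r′ → (w₁ w₂ : ℕ → ℕ) →
  Σ (FinSubset (2 * suc s′ + 2 * r′) (suc s′)) λ S₁ → Σ (FinSubset (2 * suc s′ + 2 * r′) (suc r′)) λ S₂ →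
    ZeroSum (suc s′) w₁ (elems S₁) × ZeroSum (suc r′) w₂ (elems S₂) × Arranged (elems S₁) (elems S₂)
arranged-zero-sum-pair {s′} {r′} 2s′≤r′ w₁ w₂
  with S₁ , S₁! , S₁-bounds , S₁-zs ← zero-sum-in-interval s′ 1 w₁
  with S₂ , S₂! , S₂-bounds , S₂-zs ← zero-sum-in-interval r′ (2 * suc s′) w₂
  = mkSub S₁ S₁! (All.map (λ (1≤x , x≤) → 1≤x , ≤-trans x≤ 1+2s′≤N) S₁-bounds) (proj₁ S₁-zs)
  , mkSub S₂ S₂! (All.map (λ (2s≤x , x≤N) → ≤-trans (s≤s z≤n) 2s≤x , x≤N) S₂-bounds) (proj₁ S₂-zs)
  , S₁-zs , S₂-zs , arranged 2s′≤r′ S₁-bounds (All.map proj₁ S₂-bounds) S₂! (proj₁ S₂-zs)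
  where
  1+2s′≤N : 1 + 2 * s′ ≤ 2 * suc s′ + 2 * r′
  1+2s′≤N = ≤-trans (n≤1+n _) (≤-trans (≤-reflexive (sym (*-suc 2 s′))) (m≤m+n _ _))

module _ {s′ r′ : ℕ} where

  N : ℕ
  N = 2 * suc s′ + 2 * r′

  prop2-upper : 2 * s′ ≤ r′ → Prop2 (suc s′) (suc r′) N
  prop2-upper 2s′≤r′ Δ
    with S₁ , S₂ , S₁-zs , S₂-zs , S₁⋯S₂ ← arranged-zero-sum-pair 2s′≤r′ (toℕ ∘ Δ) (toℕ ∘ Δ) =
    S₁ , S₂ , zero-sum⇒monochromatic Δ (elems S₁) S₁-zs , zero-sum⇒monochromatic Δ (elems S₂) S₂-zs , S₁⋯S₂

  propZ-upper : 2 * s′ ≤ r′ → PropZ (suc s′) (suc r′) N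
  propZ-upper 2s′≤r′ Δ
    with S₁ , S₂ , (_ , s∣ΣS₁) , (_ , r∣ΣS₂) , S₁⋯S₂ ←
           arranged-zero-sum-pair 2s′≤r′ (residue (suc s′) Δ) (residue (suc r′) Δ) =
    S₁ , S₂ , residue-zero-sum⇒ZeroSumMod (suc s′) Δ (elems S₁) s∣ΣS₁
            , residue-zero-sum⇒ZeroSumMod (suc r′) Δ (elems S₂) r∣ΣS₂ , S₁⋯S₂

  prop2-lower : ∀ {n} → n < N → ¬ Prop2 (suc s′) (suc r′) n
  prop2-lower n<N P with S₁ , S₂ , mono₁ , mono₂ , max<min , _ ← P parity =
    <⇒≱ n<N (parity-lower-bound S₁ S₂ mono₁ mono₂ max<min)

  propZ-lower : ∀ {n} → n < N → ¬ PropZ (suc s′) (suc r′) n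
  propZ-lower n<N P with S₁ , S₂ , zs₁ , zs₂ , max<min , _ ← P (λ x → ℤ.+ toℕ (parity x)) =
    <⇒≱ n<N (parity-lower-bound S₁ S₂ (parity-zero-sum⇒monochromatic S₁ zs₁)
                                      (parity-zero-sum⇒monochromatic S₂ zs₂) max<min)

theorem3p4 : (s r : ℕ) → 2 ≤ s → s ≤ r → 2 * s ∸ 2 < r →
    IsLeastPositive (Prop2 s r) (2 * s + 2 * r ∸ 2) ×
    IsLeastPositive (PropZ s r) (2 * s + 2 * r ∸ 2)
theorem3p4 (suc s′) zero     _ _ ()
theorem3p4 (suc s′) (suc r′) _ _ 2s∸2<r =
  subst (λ N → IsLeastPositive (Prop2 (suc s′) (suc r′)) N × IsLeastPositive (PropZ (suc s′) (suc r′)) N) (sym N≡)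
    ( (s≤s z≤n , prop2-upper 2s′≤r′ , λ _ _ → prop2-lower)
    , (s≤s z≤n , propZ-upper 2s′≤r′ , λ _ _ → propZ-lower) )
  where
  2s′≤r′ : 2 * s′ ≤ r′
  2s′≤r′ = ≤-pred (subst (_< suc r′) (sym (*-distribˡ-∸ 2 (suc s′) 1)) 2s∸2<r)
  N≡ : 2 * suc s′ + 2 * suc r′ ∸ 2 ≡ 2 * suc s′ + 2 * r′
  N≡ = trans (+-∸-assoc (2 * suc s′) (*-monoʳ-≤ 2 (s≤s z≤n)))
             (cong (2 * suc s′ +_) (sym (*-distribˡ-∸ 2 (suc r′) 1)))
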